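{- Let $\mathbf{F}=\langle F;\oplus,-,{}^+,{}^-,0,1\rangle$ be a flat strong quasi-MV* algebra. Then $x\oplus y=0$ for all $x,y\in F$.
   Context: A quasi-MV* algebra is an algebra $\langle A;\oplus,-,{}^+,{}^-,0,1\rangle$ of type $\langle 2,1,1,1,0,0\rangle$ such that for all $x,y,z$: (1) $x\oplus y=y\oplus x$; (2) $(1\oplus x)\oplus(y\oplus(1\oplus z))=((1\oplus x)\oplus y)\oplus(1\oplus z)$; (3) $(x\oplus1)\oplus1=1$; (4) $(x\oplus y)\oplus0=x\oplus y$; (5) $x^+\oplus0=(x\oplus0)^+=1\oplus(-1\oplus x)$ and $x^-\oplus0=(x\oplus0)^-=-1\oplus(1\oplus x)$; (6) $x\oplus y=(x^+\oplus y^+)\oplus(x^-\oplus y^-)$; (7) $0=-0$; (8) $x\oplus(-x)=0$; (9) $-(x\oplus y)=(-x)\oplus(-y)$; (10) $-(-x)=x$; (11) $(-x\oplus(x\oplus y))^+=-x^+\oplus(x^+\oplus y^+)$; (12)–(14) $\vee$ is commutative, associative, and $x\oplus(y\vee z)=(x\oplus y)\vee(x\oplus z)$; where $x\vee y:=(x^+\oplus(-x^+\oplus y^+)^+)\oplus(x^-\oplus(-x^-\oplus y^-)^+)$. It is strong if $x^+=x^+\oplus0$ and $x^-=x^-\oplus0$ for all $x$; a strong quasi-MV* algebra is flat if $0=1$. -}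

module Defs where

open import Level using (Level; suc)
open import Relation.Binary.PropositionalEquality using (_≡_)

record QuasiMVStar (a : Level) : Set (suc a) where
  infixl 6 _⊕_
  field
    Carrier : Set a
    _⊕_ : Carrier → Carrier → Carrier
    -_  : Carrier → Carrier
    _⁺  : Carrier → Carrier
    _⁻  : Carrier → Carrier
    𝟘 : Carrier
    𝟙 : Carrier

  _∨_ : Carrier → Carrier → Carrier
  x ∨ y = ((x ⁺) ⊕ (((- (x ⁺)) ⊕ (y ⁺)) ⁺)) ⊕ ((x ⁻) ⊕ (((- (x ⁻)) ⊕ (y ⁻)) ⁺))

  field
    ax1  : ∀ x y → x ⊕ y ≡ y ⊕ x
    ax2  : ∀ x y z → (𝟙 ⊕ x) ⊕ (y ⊕ (𝟙 ⊕ z)) ≡ ((𝟙 ⊕ x) ⊕ y) ⊕ (𝟙 ⊕ z)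
    ax3  : ∀ x → (x ⊕ 𝟙) ⊕ 𝟙 ≡ 𝟙
    ax4  : ∀ x y → (x ⊕ y) ⊕ 𝟘 ≡ x ⊕ y
    ax5a : ∀ x → (x ⁺) ⊕ 𝟘 ≡ (x ⊕ 𝟘) ⁺
    ax5b : ∀ x → (x ⊕ 𝟘) ⁺ ≡ 𝟙 ⊕ ((- 𝟙) ⊕ x)
    ax5c : ∀ x → (x ⁻) ⊕ 𝟘 ≡ (x ⊕ 𝟘) ⁻
    ax5d : ∀ x → (x ⊕ 𝟘) ⁻ ≡ (- 𝟙) ⊕ (𝟙 ⊕ x)
    ax6  : ∀ x y → x ⊕ y ≡ ((x ⁺) ⊕ (y ⁺)) ⊕ ((x ⁻) ⊕ (y ⁻))
    ax7  : 𝟘 ≡ - 𝟘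
    ax8  : ∀ x → x ⊕ (- x) ≡ 𝟘
    ax9  : ∀ x y → - (x ⊕ y) ≡ (- x) ⊕ (- y)
    ax10 : ∀ x → - (- x) ≡ x
    ax11 : ∀ x y → ((- x) ⊕ (x ⊕ y)) ⁺ ≡ (- (x ⁺)) ⊕ ((x ⁺) ⊕ (y ⁺))
    ax12 : ∀ x y → x ∨ y ≡ y ∨ x
    ax13 : ∀ x y z → x ∨ (y ∨ z) ≡ (x ∨ y) ∨ z
    ax14 : ∀ x y z → x ⊕ (y ∨ z) ≡ (x ⊕ y) ∨ (x ⊕ z)

module _ {a : Level} (A : QuasiMVStar a) where
  open QuasiMVStar A

  IsStrong : Set a
  IsStrong = (∀ x → x ⁺ ≡ (x ⁺) ⊕ 𝟘) × (∀ x → x ⁻ ≡ (x ⁻) ⊕ 𝟘)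
    where open import Data.Product using (_×_)

  IsFlat : Set a
  IsFlat = IsStrong × (𝟘 ≡ 𝟙)
    where open import Data.Product using (_×_)

module Submission where

open import Defs
open import Level using (Level)
open import Relation.Binary.PropositionalEquality using (_≡_; sym; cong; module ≡-Reasoning)
open import Data.Product using (_,_)

-- Sums absorb 0 on the right, and absorbing 1 twice yields 1; so once 0 = 1,
-- every sum collapses to 1 = 0.

module _ {a : Level} (A : QuasiMVStar a) where
  open QuasiMVStar A
  open ≡-Reasoning

  ⊕-𝟘-𝟘-absorbʳ : ∀ x y → (x ⊕ y) ⊕ 𝟘 ⊕ 𝟘 ≡ x ⊕ y
  ⊕-𝟘-𝟘-absorbʳ x y = begin
    (x ⊕ y) ⊕ 𝟘 ⊕ 𝟘  ≡⟨ ax4 (x ⊕ y) 𝟘 ⟩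
    (x ⊕ y) ⊕ 𝟘      ≡⟨ ax4 x y ⟩
    x ⊕ y            ∎

  𝟘≡𝟙⇒⊕≡𝟙 : 𝟘 ≡ 𝟙 → ∀ x y → x ⊕ y ≡ 𝟙
  𝟘≡𝟙⇒⊕≡𝟙 𝟘≡𝟙 x y = begin
    x ⊕ y            ≡⟨ sym (⊕-𝟘-𝟘-absorbʳ x y) ⟩
    (x ⊕ y) ⊕ 𝟘 ⊕ 𝟘  ≡⟨ cong (λ z → (x ⊕ y) ⊕ z ⊕ z) 𝟘≡𝟙 ⟩
    (x ⊕ y) ⊕ 𝟙 ⊕ 𝟙  ≡⟨ ax3 (x ⊕ y) ⟩
    𝟙                ∎

lemma3p1 : ∀ {a : Level} (F : QuasiMVStar a) → IsFlat F →
    ∀ x y → QuasiMVStar._⊕_ F x y ≡ QuasiMVStar.𝟘 F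
lemma3p1 F (_ , 𝟘≡𝟙) x y = begin
  x ⊕ y  ≡⟨ 𝟘≡𝟙⇒⊕≡𝟙 F 𝟘≡𝟙 x y ⟩
  𝟙      ≡⟨ sym 𝟘≡𝟙 ⟩
  𝟘      ∎
  where
    open QuasiMVStar F
    open ≡-Reasoning
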